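{- If $G$ is a chordal graph, then $\operatorname{pg}(G)=0$.
   Context: Graphs are finite, connected, unweighted, undirected and simple; $d_G$ is shortest-path distance; $\Pr(x,S)=\{u\in S\mid d_G(u,x)=\min_{w\in S}d_G(w,x)\}$. A graph is chordal if every cycle of length at least four has a chord. Projection gap: for an integer $\gamma\ge0$, $G$ has projection gap at most $\gamma$ if for every shortest path $P=(v_0,\dots,v_l)$ (with $d_G(v_0,v_i)=i$), every vertex $x$ and every $v_i,v_k\in\Pr(x,P)$ with $i<k$, $d_G(v_i,v_k)>\gamma+1$ implies there is $v_j\in\Pr(x,P)$ with $i<j<k$; $\operatorname{pg}(G)$ is the least such $\gamma$. -}

module Defs where

open import Data.Nat using (ℕ; zero; suc; _+_; _∸_; _≤_; _<_)
open import Data.Fin using (Fin)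
open import Data.Product using (Σ; ∃; ∃-syntax; _×_; _,_)
open import Relation.Binary.PropositionalEquality using (_≡_)
open import Relation.Nullary using (¬_; Dec)

record Graph : Set₁ where
  field
    n      : ℕ
    Adj    : Fin n → Fin n → Set
    adj?   : ∀ u v → Dec (Adj u v)
    sym    : ∀ {u v} → Adj u v → Adj v u
    irrefl : ∀ {u} → ¬ Adj u u

module _ (G : Graph) where
  open Graph G

  Vertex : Set
  Vertex = Fin n

  data Walk : Vertex → Vertex → ℕ → Set where
    here : ∀ {u} → Walk u u 0
    step : ∀ {u w v k} → Adj u w → Walk w v k → Walk u v (suc k)

  Connected : Set
  Connected = ∀ u v → ∃[ k ] Walk u v k

  Dist : Vertex → Vertex → ℕ → Set
  Dist u v k = Walk u v k × (∀ m → Walk u v m → k ≤ m)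

  record Cycle (m : ℕ) : Set where
    field
      c        : ℕ → Vertex
      long     : 4 ≤ m
      distinct : ∀ i j → i < m → j < m → c i ≡ c j → i ≡ j
      edges    : ∀ i → suc i < m → Adj (c i) (c (suc i))
      closing  : Adj (c (m ∸ 1)) (c 0)

  HasChord : ∀ {m} → Cycle m → Set
  HasChord {m} C =
    ∃[ i ] ∃[ j ] (i < j × j < m × ¬ (j ≡ suc i) × ¬ (i ≡ 0 × j ≡ m ∸ 1)
                   × Adj (Cycle.c C i) (Cycle.c C j))

  Chordal : Set
  Chordal = ∀ m (C : Cycle m) → HasChord C

  record ShortestPath : Set where
    field
      l    : ℕ
      v    : ℕ → Vertex
      adj  : ∀ i → i < l → Adj (v i) (v (suc i))
      dist : ∀ i → i ≤ l → Dist (v 0) (v i) i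

  InPr : (x : Vertex) (P : ShortestPath) → ℕ → Set
  InPr x P i =
    i ≤ ShortestPath.l P ×
    ∃[ d ] (Dist (ShortestPath.v P i) x d ×
            (∀ j d' → j ≤ ShortestPath.l P → Dist (ShortestPath.v P j) x d' → d ≤ d'))

  PGAtMost : ℕ → Set
  PGAtMost γ =
    ∀ (P : ShortestPath) (x : Vertex) (i k : ℕ) → i < k →
    InPr x P i → InPr x P k →
    (∃[ d ] (Dist (ShortestPath.v P i) (ShortestPath.v P k) d × suc γ < d)) →
    ∃[ j ] (i < j × j < k × InPr x P j)

  IsPG : ℕ → Set
  IsPG γ = PGAtMost γ × (∀ γ' → PGAtMost γ' → γ ≤ γ')

-- Suppose v i and v k lie in Pr(x, P), are not adjacent, and nothing strictly between them
-- does. With r = d(v i, x) = d(v k, x), the segment T = v i … v k is an induced path whose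
-- interior lies farther than r from x. Geodesics from v i and v k down to x, one level of
-- d(·, x) per step, meet at the bottom; with T they bound a "funnel" whose boundary is a
-- cycle of length at least 4. Since d(·, x) changes by at most one along an edge, a chord of
-- that cycle either joins vertices two levels apart, joins non-consecutive vertices of the
-- shortest path, or cuts off a strictly smaller funnel (whose descents meet, or end in
-- adjacent vertices). Chordality thus yields an infinite descent of funnels.

module Submission where

open import Defs
open import Data.Nat using (ℕ; zero; suc; _+_; _∸_; _≤_; _<_; _≤?_; _<?_; _≟_; z≤n; s≤s; s≤s⁻¹; z<s; anyUpTo?)
open import Data.Nat.Properties
open import Data.Nat.Induction using (<-wellFounded)
open import Induction.WellFounded using (Acc; acc)
open import Data.Fin using () renaming (_≟_ to _≟ᶠ_)
open import Data.Fin.Properties using (any?)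
open import Data.Product
open import Data.Sum using (_⊎_; inj₁; inj₂)
open import Data.Empty using (⊥; ⊥-elim)
open import Function using (_∘_)
open import Relation.Nullary
open import Relation.Nullary.Decidable using (_×-dec_)
open import Relation.Binary.PropositionalEquality
open import Relation.Binary.Definitions using (tri<; tri≈; tri>)

≤-+-≡⇒≡ : ∀ {m n o p} → m ≤ n → o ≤ p → m + o ≡ n + p → m ≡ n × o ≡ p
≤-+-≡⇒≡ {m} {n} {o} {p} m≤n o≤p m+o≡n+p with m≤n⇒m<n∨m≡n m≤n
... | inj₁ m<n = ⊥-elim (<-irrefl m+o≡n+p (+-mono-<-≤ m<n o≤p))
... | inj₂ refl = refl , +-cancelˡ-≡ m o p m+o≡n+p

module _ (G : Graph) where
  open Graph G using (Adj; adj?)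

  snoc : ∀ {u w v k} → Walk G u w k → Adj w v → Walk G u v (suc k)
  snoc here        e = step e here
  snoc (step a wk) e = step a (snoc wk e)

  walk-zero⇒≡ : ∀ {u v} → Walk G u v 0 → u ≡ v
  walk-zero⇒≡ here = refl

  walk? : ∀ k u v → Dec (Walk G u v k)
  walk? zero u v with u ≟ᶠ v
  ... | yes refl = yes here
  ... | no u≢v   = no λ { here → u≢v refl }
  walk? (suc k) u v with any? (λ w → adj? u w ×-dec walk? k w v)
  ... | yes (w , e , wk) = yes (step e wk)
  ... | no ¬next         = no λ { (step e wk) → ¬next (_ , e , wk) }

  Dist-unique : ∀ {u v k k'} → Dist G u v k → Dist G u v k' → k ≡ k'
  Dist-unique (wk , min) (wk' , min') = ≤-antisym (min _ wk') (min' _ wk)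

  walk⇒Dist : ∀ {u v k} → Walk G u v k → ∃[ d ] Dist G u v d
  walk⇒Dist {u} {v} {k} = go k (<-wellFounded k)
    where
    go : ∀ k → Acc _<_ k → Walk G u v k → ∃[ d ] Dist G u v d
    go k (acc shorter) wk with anyUpTo? (λ d → walk? d u v) k
    ... | yes (d , d<k , wd) = go d (shorter d<k) wd
    ... | no ¬shorter        = k , wk , λ d wd → ≮⇒≥ λ d<k → ¬shorter (d , d<k , wd)

  module _ (P : ShortestPath G) where
    open ShortestPath P

    shortestPath-injective : ∀ {i j} → i < j → j ≤ l → v i ≢ v j
    shortestPath-injective {i} {j} i<j j≤l vi≡vj =
      <⇒≱ i<j (proj₂ (dist j j≤l) i (subst (λ z → Walk G (v 0) z i) vi≡vj
                                         (proj₁ (dist i (≤-trans (<⇒≤ i<j) j≤l)))))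

    shortestPath-induced : ∀ {i j} → 2 + i ≤ j → j ≤ l → ¬ Adj (v i) (v j)
    shortestPath-induced {i} {j} 2+i≤j j≤l e =
      <⇒≱ 2+i≤j (proj₂ (dist j j≤l) (suc i) (snoc (proj₁ (dist i i≤l)) e))
      where
      i≤l : i ≤ l
      i≤l = ≤-trans (m≤n+m i 2) (≤-trans 2+i≤j j≤l)

module _ (G : Graph) (f : Vertex G → ℕ) where
  open Graph G using (Adj)

  record Descent (r s : ℕ) (u : Vertex G) : Set where
    field
      path  : ℕ → Vertex G
      start : path 0 ≡ u
      level : ∀ t → t ≤ s → f (path t) + t ≡ r
      adj   : ∀ t → t < s → Adj (path t) (path (suc t))

  truncate : ∀ {r s t u} → t ≤ s → Descent r s u → Descent r t u
  truncate t≤s D = record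
    { path  = path
    ; start = start
    ; level = λ t' t'≤t → level t' (≤-trans t'≤t t≤s)
    ; adj   = λ t' t'<t → adj t' (<-≤-trans t'<t t≤s)
    }
    where open Descent D

  splice : ℕ → (ℕ → Vertex G) → (ℕ → Vertex G) → ℕ → Vertex G
  splice t a b u with u ≤? t
  ... | yes _ = a u
  ... | no _  = b u

  splice-≤ : ∀ t a b {u} → u ≤ t → splice t a b u ≡ a u
  splice-≤ t a b {u} u≤t with u ≤? t
  ... | yes _  = refl
  ... | no u≰t = ⊥-elim (u≰t u≤t)

  splice-> : ∀ t a b {u} → t < u → splice t a b u ≡ b u
  splice-> t a b {u} t<u with u ≤? t
  ... | yes u≤t = ⊥-elim (<⇒≱ t<u u≤t)
  ... | no _    = refl

  cross : ∀ {r s s' u u'} (D : Descent r s u) (D' : Descent r s' u') t → t ≤ s → suc t ≤ s' →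
          Adj (Descent.path D t) (Descent.path D' (suc t)) → Descent r (suc t) u
  cross D D' t t≤s t<s' e = record
    { path  = splice t a b
    ; start = trans (splice-≤ t a b z≤n) (Descent.start D)
    ; level = level
    ; adj   = adj
    }
    where
    a = Descent.path D
    b = Descent.path D'

    level : ∀ t' → t' ≤ suc t → f (splice t a b t') + t' ≡ _
    level t' t'≤1+t with ≤-<-connex t' t
    ... | inj₁ t'≤t = trans (cong (λ z → f z + t') (splice-≤ t a b t'≤t)) (Descent.level D t' (≤-trans t'≤t t≤s))
    ... | inj₂ t<t' = trans (cong (λ z → f z + t') (splice-> t a b t<t')) (Descent.level D' t' (≤-trans t'≤1+t t<s'))

    adj : ∀ t' → t' < suc t → Adj (splice t a b t') (splice t a b (suc t'))
    adj t' t'<1+t with m<1+n⇒m<n∨m≡n t'<1+t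
    ... | inj₁ t'<t = subst₂ Adj (sym (splice-≤ t a b (<⇒≤ t'<t))) (sym (splice-≤ t a b t'<t)) (Descent.adj D t' (<-≤-trans t'<t t≤s))
    ... | inj₂ refl = subst₂ Adj (sym (splice-≤ t a b ≤-refl)) (sym (splice-> t a b ≤-refl)) e

  cross-end : ∀ {r s s' u u'} (D : Descent r s u) (D' : Descent r s' u') t (t≤s : t ≤ s) (t<s' : suc t ≤ s') e →
              Descent.path (cross D D' t t≤s t<s' e) (suc t) ≡ Descent.path D' (suc t)
  cross-end D D' t t≤s t<s' e = splice-> t (Descent.path D) (Descent.path D') ≤-refl

module Levels (G : Graph) (connected : Connected G) (x : Vertex G) where
  open Graph G using (Adj)

  level : Vertex G → ℕ
  level u = proj₁ (walk⇒Dist G (proj₂ (connected u x)))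

  level-Dist : ∀ u → Dist G u x (level u)
  level-Dist u = proj₂ (walk⇒Dist G (proj₂ (connected u x)))

  Dist⇒level : ∀ {u k} → Dist G u x k → level u ≡ k
  Dist⇒level = Dist-unique G (level-Dist _)

  level-lipschitz : ∀ {u w} → Adj u w → level u ≤ suc (level w)
  level-lipschitz {u} {w} e = proj₂ (level-Dist u) _ (step e (proj₁ (level-Dist w)))

  level≡0⇒≡x : ∀ {u} → level u ≡ 0 → u ≡ x
  level≡0⇒≡x {u} eq = walk-zero⇒≡ G (subst (Walk G u x) eq (proj₁ (level-Dist u)))

  geodesic-descent : ∀ {k u} → Dist G u x k → Descent G level k k u
  geodesic-descent {zero} {u} D = record
    { path  = λ _ → u
    ; start = refl
    ; level = λ { .0 z≤n → trans (+-identityʳ _) (Dist⇒level D) }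
    ; adj   = λ _ ()
    }
  geodesic-descent {suc k} {u} D@(step {w = w} e wk , min) = record
    { path  = path
    ; start = refl
    ; level = level'
    ; adj   = adj
    }
    where
    rest : Descent G level k k w
    rest = geodesic-descent (wk , λ k' wk' → s≤s⁻¹ (min (suc k') (step e wk')))

    path : ℕ → Vertex G
    path zero    = u
    path (suc t) = Descent.path rest t

    level' : ∀ t → t ≤ suc k → level (path t) + t ≡ suc k
    level' zero    _         = trans (+-identityʳ _) (Dist⇒level D)
    level' (suc t) (s≤s t≤k) = trans (+-suc _ t) (cong suc (Descent.level rest t t≤k))

    adj : ∀ t → t < suc k → Adj (path t) (path (suc t))
    adj zero    _         = subst (Adj u) (sym (Descent.start rest)) e
    adj (suc t) (s≤s t<k) = Descent.adj rest t t<k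

  descent-bottom : ∀ {k u} (D : Descent G level k k u) → Descent.path D k ≡ x
  descent-bottom {k} D = level≡0⇒≡x (+-cancelʳ-≡ k _ 0 (Descent.level D k ≤-refl))

module NoFunnel
  (G : Graph) (chordal : Chordal G)
  (f : Vertex G → ℕ) (f-lipschitz : ∀ {u w} → Graph.Adj G u w → f u ≤ suc (f w))
  (T : ℕ → Vertex G) (m r : ℕ) (2≤m : 2 ≤ m)
  (T-adj : ∀ {p} → p < m → Graph.Adj G (T p) (T (suc p)))
  (T-induced : ∀ {p q} → 2 + p ≤ q → q ≤ m → ¬ Graph.Adj G (T p) (T q))
  (T-injective : ∀ {p q} → p < q → q ≤ m → T p ≢ T q)
  (T-above : ∀ {p} → p ≤ m → r ≤ f (T p))
  (T-interior-above : ∀ {p} → 0 < p → p < m → r < f (T p))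
  where

  open Graph G renaming (sym to Adj-sym)

  level-gap : ∀ {u w t t'} → f u + t ≡ r → f w + t' ≡ r → 2 + t ≤ t' → ¬ Adj u w
  level-gap {u} {w} {t} {t'} fu ft 2+t≤t' e =
    <⇒≱ (+-cancelʳ-< t (suc (f w)) (f u) fw<fu) (f-lipschitz e)
    where
    fw<fu : suc (f w) + t < f u + t
    fw<fu = begin-strict
      suc (f w) + t ≡⟨ +-suc (f w) t ⟨
      f w + suc t   <⟨ +-monoʳ-< (f w) 2+t≤t' ⟩
      f w + t'      ≡⟨ trans ft (sym fu) ⟩
      f u + t       ∎
      where open ≤-Reasoning

  same-depth : ∀ {u t t'} → f u + t ≡ r → f u + t' ≡ r → t ≡ t'
  same-depth {u} fu fu' = +-cancelˡ-≡ (f u) _ _ (trans fu (sym fu'))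

  T-≢-below : ∀ {p d t} → p ≤ m → 1 ≤ t → f d + t ≡ r → T p ≢ d
  T-≢-below {p} {d} {t} p≤m 1≤t fd refl = <⇒≱ (subst (f d <_) fd (m<m+n (f d) 1≤t)) (T-above p≤m)

  T-end : ∀ {p} → p ≤ m → f (T p) ≤ r → p ≡ 0 ⊎ p ≡ m
  T-end {zero}  _   _ = inj₁ refl
  T-end {suc p} 1+p≤m fTp≤r with m≤n⇒m<n∨m≡n 1+p≤m
  ... | inj₁ 1+p<m = ⊥-elim (<⇒≱ (T-interior-above z<s 1+p<m) fTp≤r)
  ... | inj₂ 1+p≡m = inj₂ 1+p≡m

  T-adjacent-below : ∀ {p d t} → p ≤ m → f d + t ≡ r → 1 ≤ t → Adj (T p) d → t ≡ 1 × (p ≡ 0 ⊎ p ≡ m)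
  T-adjacent-below {p} {d} {t} p≤m fd 1≤t e = t≡1 , T-end p≤m fTp≤r
    where
    r≤1+fd : f d + t ≤ f d + 1
    r≤1+fd = ≤-trans (≤-reflexive fd) (≤-trans (T-above p≤m) (≤-trans (f-lipschitz e) (≤-reflexive (+-comm 1 (f d)))))
    t≡1 : t ≡ 1
    t≡1 = ≤-antisym (+-cancelˡ-≤ (f d) t 1 r≤1+fd) 1≤t
    fTp≤r : f (T p) ≤ r
    fTp≤r = ≤-trans (f-lipschitz e) (≤-reflexive (trans (+-comm 1 (f d)) (trans (cong (f d +_) (sym t≡1)) fd)))

  data Join : ℕ → Vertex G → Vertex G → Set where
    meet : ∀ {u v} → u ≡ v → Join 0 u v
    edge : ∀ {u v} → Adj u v → Join 1 u v

  Join≤1 : ∀ {j u v} → Join j u v → j ≤ 1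
  Join≤1 (meet _) = z≤n
  Join≤1 (edge _) = ≤-refl

  record Funnel (s j : ℕ) : Set where
    field
      1≤s   : 1 ≤ s
      left  : Descent G f r s (T 0)
      right : Descent G f r s (T m)
      join  : Join j (Descent.path left s) (Descent.path right s)

  size : ℕ → ℕ → ℕ
  size s j = s + (s + j)

  record SmallerThan (s j : ℕ) : Set where
    constructor shrunk
    field
      {s' j'} : ℕ
      smaller : size s' j' < size s j
      funnel  : Funnel s' j'

  module _ {s j} (F : Funnel s j) where
    open Funnel F
    private
      a = Descent.path left
      b = Descent.path right

    shorten : ∀ {t j'} → 1 ≤ t → t ≤ s → Join j' (a t) (b t) → Funnel t j'
    shorten 1≤t t≤s J = record
      { 1≤s = 1≤t ; left = truncate G f t≤s left ; right = truncate G f t≤s right ; join = J }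

    cross-left : ∀ t → suc t ≤ s → Adj (a t) (b (suc t)) → Funnel (suc t) 0
    cross-left t t<s e = record
      { 1≤s   = s≤s z≤n
      ; left  = cross G f left right t (<⇒≤ t<s) t<s e
      ; right = truncate G f t<s right
      ; join  = meet (cross-end G f left right t (<⇒≤ t<s) t<s e)
      }

    cross-right : ∀ t → suc t ≤ s → Adj (b t) (a (suc t)) → Funnel (suc t) 0
    cross-right t t<s e = record
      { 1≤s   = s≤s z≤n
      ; left  = truncate G f t<s left
      ; right = cross G f right left t (<⇒≤ t<s) t<s e
      ; join  = meet (sym (cross-end G f right left t (<⇒≤ t<s) t<s e))
      }

  module FunnelCycle {s j} (F : Funnel s j) where
    open Funnel F
    open Descent left  renaming (path to a; start to a-start; level to a-level; adj to a-adj)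
    open Descent right renaming (path to b; start to b-start; level to b-level; adj to b-adj)

    w : ℕ
    w = s + j

    M : ℕ
    M = m + size s j

    s≤w : s ≤ w
    s≤w = m≤m+n s j

    w≤1+s : w ≤ suc s
    w≤1+s = ≤-trans (+-monoʳ-≤ s (Join≤1 join)) (≤-reflexive (+-comm s 1))

    <w⇒≤s : ∀ {u} → u < w → u ≤ s
    <w⇒≤s u<w = s≤s⁻¹ (≤-trans u<w w≤1+s)

    2+m≤M : 2 + m ≤ M
    2+m≤M = ≤-trans (≤-reflexive (+-comm 2 m)) (+-monoʳ-≤ m (+-mono-≤ 1≤s (≤-trans 1≤s s≤w)))

    vertex' : ∀ p → Dec (p ≤ m) → Dec (p ≤ m + s) → Vertex G
    vertex' p (yes _) _       = T p
    vertex' p (no _)  (yes _) = b (p ∸ m)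
    vertex' p (no _)  (no _)  = a (M ∸ p)

    -- The cycle T 0, …, T m = b 0, b 1, …, b s, a (w ∸ 1), …, a 1; for j = 0 the
    -- common bottom vertex a s = b s is listed once.
    vertex : ℕ → Vertex G
    vertex p = vertex' p (p ≤? m) (p ≤? m + s)

    data At (p : ℕ) : Vertex G → Set where
      on-T     : p ≤ m → At p (T p)
      on-right : ∀ {t} → 1 ≤ t → t ≤ s → p ≡ m + t → At p (b t)
      on-left  : ∀ {u} → 1 ≤ u → u < w → p + u ≡ M → At p (a u)

    left-position : ∀ {p u} → u < w → p + u ≡ M → m + s < p
    left-position {p} {u} u<w p+u≡M = ≰⇒> λ p≤m+s →
      <-irrefl (trans p+u≡M (sym (+-assoc m s w))) (+-mono-≤-< p≤m+s u<w)

    at : ∀ p → p < M → At p (vertex p)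
    at p p<M = at' (p ≤? m) (p ≤? m + s)
      where
      at' : (d : Dec (p ≤ m)) (d' : Dec (p ≤ m + s)) → At p (vertex' p d d')
      at' (yes p≤m) _          = on-T p≤m
      at' (no p≰m)  (yes p≤m+s) =
        on-right (m<n⇒0<n∸m (≰⇒> p≰m))
                 (≤-trans (∸-monoˡ-≤ m p≤m+s) (≤-reflexive (m+n∸m≡n m s)))
                 (sym (m+[n∸m]≡n (<⇒≤ (≰⇒> p≰m))))
      at' (no _)    (no p≰m+s) =
        on-left (m<n⇒0<n∸m p<M) (M∸p<w (≰⇒> p≰m+s)) (m+[n∸m]≡n (<⇒≤ p<M))
        where
        M∸p<w : m + s < p → M ∸ p < w
        M∸p<w m+s<p = +-cancelˡ-< p (M ∸ p) w (begin-strict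
          p + (M ∸ p) ≡⟨ m+[n∸m]≡n (<⇒≤ p<M) ⟩
          M           ≡⟨ +-assoc m s w ⟨
          m + s + w   <⟨ +-monoˡ-< w m+s<p ⟩
          p + w       ∎)
          where open ≤-Reasoning

    module _ (a≢b : ∀ {t} → 1 ≤ t → t < w → a t ≢ b t) where

      right≢left : ∀ {t u} → t ≤ s → 1 ≤ u → u < w → b t ≢ a u
      right≢left {t} {u} t≤s 1≤u u<w bt≡au = a≢b 1≤u u<w (trans (sym bt≡au) (cong b t≡u))
        where
        t≡u : t ≡ u
        t≡u = same-depth (b-level t t≤s) (subst (λ z → f z + u ≡ r) (sym bt≡au) (a-level u (<w⇒≤s u<w)))

      At-injective : ∀ {p q x y} → At p x → At q y → x ≡ y → p ≡ q
      At-injective {p} {q} (on-T p≤m) (on-T q≤m) eq with <-cmp p q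
      ... | tri< p<q _ _ = ⊥-elim (T-injective p<q q≤m eq)
      ... | tri≈ _ p≡q _ = p≡q
      ... | tri> _ _ q<p = ⊥-elim (T-injective q<p p≤m (sym eq))
      At-injective (on-T p≤m) (on-right 1≤t t≤s _) eq = ⊥-elim (T-≢-below p≤m 1≤t (b-level _ t≤s) eq)
      At-injective (on-T p≤m) (on-left 1≤u u<w _) eq = ⊥-elim (T-≢-below p≤m 1≤u (a-level _ (<w⇒≤s u<w)) eq)
      At-injective (on-right 1≤t t≤s _) (on-T q≤m) eq = ⊥-elim (T-≢-below q≤m 1≤t (b-level _ t≤s) (sym eq))
      At-injective (on-right {t} _ t≤s p≡m+t) (on-right {t'} _ t'≤s q≡m+t') eq =
        trans p≡m+t (trans (cong (m +_) t≡t') (sym q≡m+t'))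
        where
        t≡t' : t ≡ t'
        t≡t' = same-depth (b-level t t≤s) (subst (λ z → f z + t' ≡ r) (sym eq) (b-level t' t'≤s))
      At-injective (on-right _ t≤s _) (on-left 1≤u u<w _) eq = ⊥-elim (right≢left t≤s 1≤u u<w eq)
      At-injective (on-left 1≤u u<w _) (on-T q≤m) eq = ⊥-elim (T-≢-below q≤m 1≤u (a-level _ (<w⇒≤s u<w)) (sym eq))
      At-injective (on-left 1≤u u<w _) (on-right _ t≤s _) eq = ⊥-elim (right≢left t≤s 1≤u u<w (sym eq))
      At-injective {p} {q} (on-left {u} _ u<w p+u≡M) (on-left {u'} _ u'<w q+u'≡M) eq =
        +-cancelʳ-≡ u p q (trans p+u≡M (trans (sym q+u'≡M) (cong (q +_) (sym u≡u'))))
        where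
        u≡u' : u ≡ u'
        u≡u' = same-depth (a-level u (<w⇒≤s u<w)) (subst (λ z → f z + u' ≡ r) (sym eq) (a-level u' (<w⇒≤s u'<w)))

    bottom-edge : ∀ {j' u} → Join j' (a s) (b s) → suc u ≡ s + j' → Adj (b s) (a u)
    bottom-edge {u = u} (meet as≡bs) 1+u≡s+0 =
      subst (λ z → Adj z (a u)) as≡bs (Adj-sym (subst (λ z → Adj (a u) (a z)) 1+u≡s (a-adj u (≤-reflexive 1+u≡s))))
      where
      1+u≡s : suc u ≡ s
      1+u≡s = trans 1+u≡s+0 (+-identityʳ s)
    bottom-edge {u = u} (edge e) 1+u≡s+1 = subst (λ z → Adj (b s) (a z)) s≡u (Adj-sym e)
      where
      s≡u : s ≡ u
      s≡u = suc-injective (trans (+-comm 1 s) (sym 1+u≡s+1))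

    At-edge : ∀ {p x y} → At p x → At (suc p) y → Adj x y
    At-edge (on-T _) (on-T 1+p≤m) = T-adj 1+p≤m
    At-edge (on-T p≤m) (on-right 1≤t _ 1+p≡m+t) with T-to-right p≤m 1≤t 1+p≡m+t
      where
      T-to-right : ∀ {p t} → p ≤ m → 1 ≤ t → suc p ≡ m + t → p ≡ m × t ≡ 1
      T-to-right {p} {t} p≤m 1≤t 1+p≡m+t = suc-injective (trans 1+p≡m+t (trans (cong (m +_) t≡1) (+-comm m 1))) , t≡1
        where
        t≡1 : t ≡ 1
        t≡1 = ≤-antisym (+-cancelˡ-≤ m t 1 (≤-trans (≤-reflexive (sym 1+p≡m+t)) (≤-trans (s≤s p≤m) (≤-reflexive (+-comm 1 m))))) 1≤t
    ... | refl , refl = subst (λ z → Adj z (b 1)) b-start (b-adj 0 1≤s)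
    At-edge (on-T p≤m) (on-left _ u<w 1+p+u≡M) =
      ⊥-elim (<⇒≱ (left-position u<w 1+p+u≡M) (≤-trans (s≤s p≤m) (≤-trans (≤-reflexive (+-comm 1 m)) (+-monoʳ-≤ m 1≤s))))
    At-edge (on-right {t} _ _ refl) (on-T 1+p≤m) = ⊥-elim (<-irrefl refl (≤-trans (s≤s (m≤m+n m t)) 1+p≤m))
    At-edge (on-right {t} _ _ refl) (on-right {t'} _ t'≤s 1+p≡m+t') =
      subst (λ z → Adj (b t) (b z)) 1+t≡t' (b-adj t (subst (_≤ s) (sym 1+t≡t') t'≤s))
      where
      1+t≡t' : suc t ≡ t'
      1+t≡t' = +-cancelˡ-≡ m _ _ (trans (+-suc m t) 1+p≡m+t')
    At-edge (on-right {t} _ t≤s refl) (on-left {u} _ u<w 1+p+u≡M) with ≤-+-≡⇒≡ t≤s u<w t+1+u≡s+w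
      where
      t+1+u≡s+w : t + suc u ≡ s + w
      t+1+u≡s+w = +-cancelˡ-≡ m _ _ (trans (trans (sym (+-assoc m t (suc u))) (+-suc (m + t) u)) 1+p+u≡M)
    ... | refl , 1+u≡w = bottom-edge join 1+u≡w
    At-edge (on-left _ u<w p+u≡M) (on-T 1+p≤m) =
      ⊥-elim (<⇒≱ (left-position u<w p+u≡M) (≤-trans (n≤1+n _) (≤-trans 1+p≤m (m≤m+n m s))))
    At-edge (on-left _ u<w p+u≡M) (on-right _ t≤s 1+p≡m+t) =
      ⊥-elim (<⇒≱ (left-position u<w p+u≡M) (≤-trans (n≤1+n _) (≤-trans (≤-reflexive 1+p≡m+t) (+-monoʳ-≤ m t≤s))))
    At-edge {p} (on-left {u} _ u<w p+u≡M) (on-left {u'} _ _ 1+p+u'≡M) =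
      subst (λ z → Adj (a z) (a u')) 1+u'≡u (Adj-sym (a-adj u' (<w⇒≤s (subst (_< w) (sym 1+u'≡u) u<w))))
      where
      1+u'≡u : suc u' ≡ u
      1+u'≡u = +-cancelˡ-≡ p _ _ (trans (+-suc p u') (trans 1+p+u'≡M (sym p+u≡M)))

    w≤1⇒s≡1∧w≡1 : w ≤ 1 → s ≡ 1 × w ≡ 1
    w≤1⇒s≡1∧w≡1 w≤1 = ≤-antisym (≤-trans s≤w w≤1) 1≤s , ≤-antisym w≤1 (≤-trans 1≤s s≤w)

    first-left-edge : Adj (a 1) (T 0)
    first-left-edge = subst (Adj (a 1)) a-start (Adj-sym (a-adj 0 1≤s))

    bottom-meet : ∀ {j'} → Join j' (a s) (b s) → s + j' ≡ s → a s ≡ b s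
    bottom-meet (meet as≡bs) _     = as≡bs
    bottom-meet (edge _)     s+1≡s = ⊥-elim (<-irrefl (sym s+1≡s) (m<m+n s z<s))

    1+[M∸1]≡M : suc (M ∸ 1) ≡ M
    1+[M∸1]≡M = m+[n∸m]≡n (≤-trans (s≤s z≤n) 2+m≤M)

    closing-edge : ∀ {x} → At (M ∸ 1) x → Adj x (T 0)
    closing-edge (on-T M∸1≤m) = ⊥-elim (<⇒≱ (≤-trans 2+m≤M (≤-reflexive (sym 1+[M∸1]≡M))) (s≤s M∸1≤m))
    closing-edge (on-right {t} _ t≤s M∸1≡m+t) = subst (λ z → Adj z (T 0)) a1≡bt first-left-edge
      where
      s+w≡1+t : s + w ≡ suc t
      s+w≡1+t = +-cancelˡ-≡ m _ _ (trans (sym 1+[M∸1]≡M) (trans (cong suc M∸1≡m+t) (sym (+-suc m t))))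
      s≡1∧w≡1 : s ≡ 1 × w ≡ 1
      s≡1∧w≡1 = w≤1⇒s≡1∧w≡1 (+-cancelˡ-≤ s w 1 (≤-trans (≤-reflexive s+w≡1+t) (≤-trans (s≤s t≤s) (≤-reflexive (+-comm 1 s)))))
      s≡1 = proj₁ s≡1∧w≡1
      w≡1 = proj₂ s≡1∧w≡1
      t≡1 : t ≡ 1
      t≡1 = suc-injective (trans (sym s+w≡1+t) (cong₂ _+_ s≡1 w≡1))
      a1≡bt : a 1 ≡ b t
      a1≡bt = trans (cong a (sym s≡1)) (trans (bottom-meet join (trans w≡1 (sym s≡1))) (cong b (trans s≡1 (sym t≡1))))
    closing-edge (on-left {u} _ _ [M∸1]+u≡M) = subst (λ z → Adj (a z) (T 0)) (sym u≡1) first-left-edge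
      where
      u≡1 : u ≡ 1
      u≡1 = +-cancelˡ-≡ (M ∸ 1) u 1 (trans [M∸1]+u≡M (trans (sym 1+[M∸1]≡M) (+-comm 1 (M ∸ 1))))

    cycle : (∀ {t} → 1 ≤ t → t < w → a t ≢ b t) → Cycle G M
    cycle a≢b = record
      { c        = vertex
      ; long     = ≤-trans (+-monoʳ-≤ 2 2≤m) 2+m≤M
      ; distinct = λ p q p<M q<M → At-injective a≢b (at p p<M) (at q q<M)
      ; edges    = λ p 1+p<M → At-edge (at p (<-trans (n<1+n p) 1+p<M)) (at (suc p) 1+p<M)
      ; closing  = closing-edge (at (M ∸ 1) (≤-reflexive 1+[M∸1]≡M))
      }

    smaller-meet : ∀ {t} → t ≤ s → t < w → size t 0 < size s j
    smaller-meet {t} t≤s t<w = +-mono-≤-< t≤s (subst (_< w) (sym (+-identityʳ t)) t<w)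

    smaller-edge : ∀ {t} → t < s → size t 1 < size s j
    smaller-edge {t} t<s = +-mono-<-≤ t<s (subst (_≤ w) (+-comm 1 t) (≤-trans t<s s≤w))

    q+1≡M⇒q≡M∸1 : ∀ {q} → q + 1 ≡ M → q ≡ M ∸ 1
    q+1≡M⇒q≡M∸1 {q} q+1≡M = trans (sym (m+n∸n≡m q 1)) (cong (_∸ 1) q+1≡M)

    left-successor : ∀ {q u t} → q + u ≡ m + (t + suc u) → q ≡ suc (m + t)
    left-successor {q} {u} {t} q+u≡ =
      +-cancelʳ-≡ u q (suc (m + t)) (trans q+u≡ (trans (sym (+-assoc m t (suc u))) (+-suc (m + t) u)))

    T-right-chord : ∀ {p q t} → suc p < q → ¬ (p ≡ 0 × q ≡ M ∸ 1) →
                    p ≤ m → 1 ≤ t → t ≤ s → q ≡ m + t → Adj (T p) (b t) → SmallerThan s j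
    T-right-chord 1+p<q ¬ends p≤m 1≤t t≤s q≡m+t e with T-adjacent-below p≤m (b-level _ t≤s) 1≤t e
    ... | refl , inj₂ refl = ⊥-elim (<-irrefl (sym (trans q≡m+t (+-comm m 1))) 1+p<q)
    ... | refl , inj₁ refl with 2 ≤? w
    ...   | yes 2≤w = shrunk (smaller-meet 1≤s 2≤w) (cross-left F 0 1≤s (subst (λ z → Adj z (b 1)) (sym a-start) e))
    ...   | no 2≰w  = ⊥-elim (¬ends (refl , q+1≡M⇒q≡M∸1 q+1≡M))
      where
      q+1≡M : _ + 1 ≡ M
      q+1≡M with w≤1⇒s≡1∧w≡1 (s≤s⁻¹ (≰⇒> 2≰w))
      ... | s≡1 , w≡1 = trans (cong (_+ 1) q≡m+t) (trans (+-assoc m 1 1) (cong (m +_) (sym (cong₂ _+_ s≡1 w≡1))))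

    T-left-chord : ∀ {p q u} → ¬ (p ≡ 0 × q ≡ M ∸ 1) →
                   p ≤ m → 1 ≤ u → u < w → q + u ≡ M → Adj (T p) (a u) → SmallerThan s j
    T-left-chord ¬ends p≤m 1≤u u<w q+u≡M e with T-adjacent-below p≤m (a-level _ (<w⇒≤s u<w)) 1≤u e
    ... | refl , inj₁ refl = ⊥-elim (¬ends (refl , q+1≡M⇒q≡M∸1 q+u≡M))
    ... | refl , inj₂ refl = shrunk (smaller-meet 1≤s u<w) (cross-right F 0 1≤s (subst (λ z → Adj z (a 1)) (sym b-start) e))

    right-left-chord : ∀ {q t u} → suc (m + t) < q → 1 ≤ t → t ≤ s → u < w → q + u ≡ M →
                       Adj (b t) (a u) → SmallerThan s j
    right-left-chord {q} {t} {u} 1+p<q 1≤t t≤s u<w q+u≡M e with <-cmp t u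
    ... | tri≈ _ refl _ with t <? s
    ...   | yes t<s = shrunk (smaller-edge t<s) (shorten F 1≤t t≤s (edge (Adj-sym e)))
    ...   | no t≮s  = ⊥-elim (<-irrefl (sym (left-successor q+u≡M')) 1+p<q)
      where
      t≡s : t ≡ s
      t≡s = ≤-antisym t≤s (≮⇒≥ t≮s)
      w≡1+t : w ≡ suc t
      w≡1+t = ≤-antisym (subst (λ z → w ≤ suc z) (sym t≡s) w≤1+s) u<w
      q+u≡M' : q + t ≡ m + (t + suc t)
      q+u≡M' = trans q+u≡M (cong₂ (λ z z' → m + (z + z')) (sym t≡s) w≡1+t)
    right-left-chord {t = t} {u} 1+p<q 1≤t t≤s u<w q+u≡M e | tri< t<u _ _ with suc t ≟ u
    ... | yes refl = shrunk (smaller-meet (<w⇒≤s u<w) u<w) (cross-right F _ (<w⇒≤s u<w) e)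
    ... | no 1+t≢u = ⊥-elim (level-gap (b-level _ t≤s) (a-level _ (<w⇒≤s u<w)) (≤∧≢⇒< t<u 1+t≢u) e)
    right-left-chord {q} {t} {u} 1+p<q 1≤t t≤s u<w q+u≡M e | tri> _ _ u<t with suc u ≟ t
    ... | no 1+u≢t = ⊥-elim (level-gap (a-level _ (<w⇒≤s u<w)) (b-level _ t≤s) (≤∧≢⇒< u<t 1+u≢t) (Adj-sym e))
    ... | yes refl with suc u <? w
    ...   | yes 1+u<w = shrunk (smaller-meet t≤s 1+u<w) (cross-left F u t≤s (Adj-sym e))
    ...   | no 1+u≮w  = ⊥-elim (<-irrefl (sym (left-successor q+u≡M')) 1+p<q)
      where
      w≤1+u : w ≤ suc u
      w≤1+u = ≮⇒≥ 1+u≮w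
      s≡1+u : s ≡ suc u
      s≡1+u = ≤-antisym (≤-trans s≤w w≤1+u) t≤s
      w≡1+u : w ≡ suc u
      w≡1+u = ≤-antisym w≤1+u (≤-trans t≤s s≤w)
      q+u≡M' : q + u ≡ m + (suc u + suc u)
      q+u≡M' = trans q+u≡M (cong₂ (λ z z' → m + (z + z')) s≡1+u w≡1+u)

    chord-shrinks : ∀ {p q x y} → suc p < q → ¬ (p ≡ 0 × q ≡ M ∸ 1) → At p x → At q y → Adj x y → SmallerThan s j
    chord-shrinks 1+p<q _ (on-T _) (on-T q≤m) e = ⊥-elim (T-induced 1+p<q q≤m e)
    chord-shrinks 1+p<q ¬ends (on-T p≤m) (on-right 1≤t t≤s q≡m+t) e = T-right-chord 1+p<q ¬ends p≤m 1≤t t≤s q≡m+t e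
    chord-shrinks _ ¬ends (on-T p≤m) (on-left 1≤u u<w q+u≡M) e = T-left-chord ¬ends p≤m 1≤u u<w q+u≡M e
    chord-shrinks 1+p<q _ (on-right {t} _ _ refl) (on-T q≤m) _ =
      ⊥-elim (<⇒≱ 1+p<q (≤-trans q≤m (≤-trans (m≤m+n m t) (n≤1+n _))))
    chord-shrinks 1+p<q _ (on-right {t} _ t≤s refl) (on-right {t'} _ t'≤s refl) e = ⊥-elim
      (level-gap (b-level t t≤s) (b-level t' t'≤s) (+-cancelˡ-< m (suc t) t' (subst (_< m + t') (sym (+-suc m t)) 1+p<q)) e)
    chord-shrinks 1+p<q _ (on-right 1≤t t≤s refl) (on-left _ u<w q+u≡M) e = right-left-chord 1+p<q 1≤t t≤s u<w q+u≡M e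
    chord-shrinks 1+p<q _ (on-left _ u<w p+u≡M) (on-T q≤m) _ =
      ⊥-elim (<⇒≱ (left-position u<w p+u≡M) (≤-trans (<⇒≤ (<-trans (n<1+n _) 1+p<q)) (≤-trans q≤m (m≤m+n m s))))
    chord-shrinks 1+p<q _ (on-left _ u<w p+u≡M) (on-right _ t≤s q≡m+t) _ =
      ⊥-elim (<⇒≱ (left-position u<w p+u≡M) (≤-trans (<⇒≤ (<-trans (n<1+n _) 1+p<q)) (≤-trans (≤-reflexive q≡m+t) (+-monoʳ-≤ m t≤s))))
    chord-shrinks {p} {q} 1+p<q _ (on-left {u} _ u<w p+u≡M) (on-left {u'} _ u'<w q+u'≡M) e =
      ⊥-elim (level-gap (a-level u' (<w⇒≤s u'<w)) (a-level u (<w⇒≤s u<w)) 2+u'≤u (Adj-sym e))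
      where
      2+u'≤u : 2 + u' ≤ u
      2+u'≤u = +-cancelˡ-≤ p (2 + u') u (begin
        p + (2 + u')   ≡⟨ trans (+-suc p (suc u')) (cong suc (+-suc p u')) ⟩
        2 + p + u'     ≤⟨ +-monoˡ-≤ u' 1+p<q ⟩
        q + u'         ≡⟨ trans q+u'≡M (sym p+u≡M) ⟩
        p + u          ∎)
        where open ≤-Reasoning

    -- Either the descents meet above the bottom (cut there), or the vertices of the cycle are distinct.
    shrinks : SmallerThan s j
    shrinks with anyUpTo? (λ t → (1 ≤? t) ×-dec (a t ≟ᶠ b t)) w
    ... | yes (t , t<w , 1≤t , at≡bt) = shrunk (smaller-meet (<w⇒≤s t<w) t<w) (shorten F 1≤t (<w⇒≤s t<w) (meet at≡bt))
    ... | no no-early-meet with chordal M (cycle λ 1≤t t<w at≡bt → no-early-meet (_ , t<w , 1≤t , at≡bt))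
    ...   | p , q , p<q , q<M , q≢1+p , ¬ends , e =
      chord-shrinks (≤∧≢⇒< p<q λ 1+p≡q → q≢1+p (sym 1+p≡q)) ¬ends (at p (<-trans p<q q<M)) (at q q<M) e

  no-funnel : ∀ {s j} → ¬ Funnel s j
  no-funnel F = go (<-wellFounded _) F
    where
    go : ∀ {s j} → Acc _<_ (size s j) → ¬ Funnel s j
    go (acc smaller) F with FunnelCycle.shrinks F
    ... | shrunk lt F' = go (smaller lt) F'

module _ (G : Graph) (connected : Connected G) (chordal : Chordal G) (P : ShortestPath G) (x : Vertex G) where
  open Graph G using (Adj)
  open ShortestPath P
  open Levels G connected x

  no-raised-segment : ∀ {i k r} → 2 + i ≤ k → k ≤ l → Dist G (v i) x r → Dist G (v k) x r →
                      (∀ {j} → j ≤ l → r ≤ level (v j)) → (∀ {j} → i < j → j < k → r < level (v j)) → ⊥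
  no-raised-segment {i} {k} {r} 2+i≤k k≤l Dᵢ Dₖ above interior-above = no-funnel funnel
    where
    m : ℕ
    m = k ∸ i

    i+m≡k : i + m ≡ k
    i+m≡k = m+[n∸m]≡n (≤-trans (m≤n+m i 2) 2+i≤k)

    T : ℕ → Vertex G
    T p = v (i + p)

    ≤m⇒≤l : ∀ {p} → p ≤ m → i + p ≤ l
    ≤m⇒≤l p≤m = ≤-trans (+-monoʳ-≤ i p≤m) (≤-trans (≤-reflexive i+m≡k) k≤l)

    open NoFunnel G chordal level level-lipschitz T m r
      (m+n≤o⇒m≤o∸n 2 2+i≤k)
      (λ {p} p<m → subst (Adj (T p) ∘ v) (sym (+-suc i p)) (adj (i + p) (subst (_≤ l) (+-suc i p) (≤m⇒≤l p<m))))
      (λ {p} {q} 2+p≤q q≤m → shortestPath-induced G P (subst (_≤ i + q) (trans (+-suc i (suc p)) (cong suc (+-suc i p))) (+-monoʳ-≤ i 2+p≤q)) (≤m⇒≤l q≤m))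
      (λ p<q q≤m → shortestPath-injective G P (+-monoʳ-< i p<q) (≤m⇒≤l q≤m))
      (λ p≤m → above (≤m⇒≤l p≤m))
      (λ 0<p p<m → interior-above (m<m+n i 0<p) (subst (i + _ <_) i+m≡k (+-monoʳ-< i p<m)))

    r≢0 : r ≢ 0
    r≢0 refl = shortestPath-injective G P (≤-trans (n≤1+n _) 2+i≤k) k≤l
      (trans (level≡0⇒≡x (Dist⇒level Dᵢ)) (sym (level≡0⇒≡x (Dist⇒level Dₖ))))

    left : Descent G level r r (T 0)
    left = subst (Descent G level r r ∘ v) (sym (+-identityʳ i)) (geodesic-descent Dᵢ)

    right : Descent G level r r (T m)
    right = subst (Descent G level r r ∘ v) (sym i+m≡k) (geodesic-descent Dₖ)

    funnel : Funnel r 0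
    funnel = record
      { 1≤s   = n≢0⇒n>0 r≢0
      ; left  = left
      ; right = right
      ; join  = meet (trans (descent-bottom left) (sym (descent-bottom right)))
      }

  projection-gapless : ∀ i k → i < k → InPr G x P i → InPr G x P k →
                       (∃[ d ] (Dist G (v i) (v k) d × 1 < d)) → ∃[ j ] (i < j × j < k × InPr G x P j)
  projection-gapless i k i<k (i≤l , r , Dᵢ , minᵢ) (k≤l , r' , Dₖ , minₖ) (d , Dᵢₖ , 1<d)
    with anyUpTo? (λ j → (i <? j) ×-dec (level (v j) ≤? r)) k
  ... | yes (j , j<k , i<j , vⱼ≤r) =
    j , i<j , j<k , ≤-trans (<⇒≤ j<k) k≤l , level (v j) , level-Dist (v j) ,
    λ j' d' j'≤l D' → ≤-trans vⱼ≤r (minᵢ j' d' j'≤l D')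
  ... | no nothing-between = ⊥-elim (no-raised-segment 2+i≤k k≤l Dᵢ Dₖ' above interior-above)
    where
    Dₖ' : Dist G (v k) x r
    Dₖ' = subst (Dist G (v k) x) (≤-antisym (minₖ i r i≤l Dᵢ) (minᵢ k r' k≤l Dₖ)) Dₖ
    2+i≤k : 2 + i ≤ k
    2+i≤k = ≤∧≢⇒< i<k λ 1+i≡k →
      <⇒≱ 1<d (proj₂ Dᵢₖ 1 (step (subst (Adj (v i) ∘ v) 1+i≡k (adj i (<-≤-trans i<k k≤l))) here))
    above : ∀ {j} → j ≤ l → r ≤ level (v j)
    above j≤l = minᵢ _ _ j≤l (level-Dist _)
    interior-above : ∀ {j} → i < j → j < k → r < level (v j)
    interior-above i<j j<k = ≰⇒> λ vⱼ≤r → nothing-between (_ , j<k , i<j , vⱼ≤r)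

lemma12 : (G : Graph) → Connected G → Chordal G → IsPG G 0
lemma12 G connected chordal = projection-gapless G connected chordal , λ _ _ → z≤n
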